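{- Let $G=(V,E)$ be a graph satisfying the standing assumptions and let $u\in V$ with $\tau(u)=3$. Then $\min_u[i+1]\preceq\min_u[i]$ for every $2\le i\le\ell_u-1$. In particular, if $2\le i\le j\le\ell_u$, then $\min_u[j]\preceq\min_u[i]$.
   Context: Standing assumptions: $\Sigma$ is a finite alphabet with a total order $\preceq$; $G=(V,E)$ is finite, $E\subseteq V\times V\times\Sigma$, every node has an incoming edge, all edges entering a node $u$ have the same label $\lambda(u)$ (edges are written $(u,v)$), and $G$ is deterministic. An occurrence of $\alpha\in\Sigma^\omega$ starting at $u$ is a sequence $(u_i)_{i\ge1}$ with $u_1=u$, $(u_{i+1},u_i)\in E$, $\lambda(u_i)=\alpha[i]$; $\min_u$ is the lexicographically smallest string in $\Sigma^\omega$ with an occurrence starting at $u$; $\alpha[i]$ is the $i$-th character of $\alpha$. For $\alpha=a\alpha'$ ($a\in\Sigma$): $\tau(\alpha)=1$ if $\alpha'\prec\alpha$, $2$ if $\alpha'=\alpha$, $3$ if $\alpha\prec\alpha'$; $\tau(u):=\tau(\min_u)$. For $u$ with $\tau(u)=3$, $\ell_u$ is the smallest integer $k\ge2$ such that $\tau(u_k)\ge2$, where $(u_i)_{i\ge1}$ is an occurrence of $\min_u$ starting at $u$ (this is well defined and independent of the chosen occurrence). -}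

module Defs where

open import Data.Nat using (ℕ; zero; suc; _∸_; _<_; _≤_)
open import Data.Fin as Fin using (Fin)
open import Data.Product using (Σ; ∃; _×_; _,_)
open import Data.Sum using (_⊎_)
open import Relation.Binary.PropositionalEquality using (_≡_)
open import Relation.Nullary using (¬_)

-- The alphabet Σ is Fin σ with its standard total order (Fin._≤_);
-- every finite totally ordered set is order-isomorphic to some Fin σ.
-- Nodes are Fin n (V finite).

-- Infinite strings Σ^ω, stored 0-based: α i is the paper's α[i+1].
Str : ℕ → Set
Str σ = ℕ → Fin σ

-- The paper's 1-based character access α[i] (intended for i ≥ 1).
_[_] : ∀ {σ} → Str σ → ℕ → Fin σ
α [ i ] = α (i ∸ 1)

-- Graph: edge (u , v) means an edge from u to v; its label is lab v (the paper's λ(v)).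
record Graph (n σ : ℕ) : Set₁ where
  field
    E : Fin n → Fin n → Set
    lab : Fin n → Fin σ
open Graph public

record StandingAssumptions {n σ : ℕ} (G : Graph n σ) : Set where
  field
    incoming      : ∀ v → ∃ λ u → E G u v
    deterministic : ∀ u v w → E G u v → E G u w → lab G v ≡ lab G w → v ≡ w

-- (w i)_{i≥0} (0-based, w i = paper's u_{i+1}) is an occurrence of α starting at u.
IsOccurrence : ∀ {n σ} → Graph n σ → Fin n → Str σ → (ℕ → Fin n) → Set
IsOccurrence G u α w =
  (w 0 ≡ u) × (∀ i → E G (w (suc i)) (w i)) × (∀ i → lab G (w i) ≡ α i)

HasOccurrence : ∀ {n σ} → Graph n σ → Fin n → Str σ → Set
HasOccurrence G u α = ∃ λ w → IsOccurrence G u α w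

_≈_ : ∀ {σ} → Str σ → Str σ → Set
α ≈ β = ∀ i → α i ≡ β i

_≺_ : ∀ {σ} → Str σ → Str σ → Set
α ≺ β = ∃ λ k → (∀ j → j < k → α j ≡ β j) × (α k Fin.< β k)

_⪯_ : ∀ {σ} → Str σ → Str σ → Set
α ⪯ β = (α ≺ β) ⊎ (α ≈ β)

IsMin : ∀ {n σ} → Graph n σ → Fin n → Str σ → Set
IsMin G u α = HasOccurrence G u α × (∀ β → HasOccurrence G u β → α ⪯ β)

tail : ∀ {σ} → Str σ → Str σ
tail α i = α (suc i)

τ≡1 : ∀ {σ} → Str σ → Set
τ≡1 α = tail α ≺ α

τ≡2 : ∀ {σ} → Str σ → Set
τ≡2 α = tail α ≈ α

τ≡3 : ∀ {σ} → Str σ → Set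
τ≡3 α = α ≺ tail α

τ≥2 : ∀ {σ} → Str σ → Set
τ≥2 α = τ≡2 α ⊎ τ≡3 α

-- ℓ is ℓ_u computed from an occurrence w of min_u starting at u (min v = min_v),
-- with 1-based node index u_k = w (k ∸ 1): the smallest k ≥ 2 with τ(u_k) ≥ 2.
IsEll : ∀ {n σ} → (Fin n → Str σ) → (ℕ → Fin n) → ℕ → Set
IsEll min w ℓ =
  (2 ≤ ℓ) × τ≥2 (min (w (ℓ ∸ 1)))
  × (∀ k → 2 ≤ k → τ≥2 (min (w (k ∸ 1))) → ℓ ≤ k)

{-# OPTIONS --safe #-}
module Submission where

-- If min_{u_k} were smaller than the suffix of min_u starting at position k,
-- splicing its occurrence onto the prefix of the occurrence of min_u would give
-- a smaller string with an occurrence at u; so min_{u_k} is that suffix. Hence an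
-- ascent min_u[k] ≺ min_u[k+1] with k ≥ 2 makes min_{u_k} smaller than its tail,
-- i.e. τ(u_k) = 3, which forces ℓ_u ≤ k.

open import Defs
open import Data.Nat using (ℕ; zero; suc; _+_; _≤_; _<_; _≤′_; ≤′-refl; ≤′-step; z≤n; s≤s)
import Data.Nat.Properties as ℕ
open import Data.Fin as Fin using (Fin)
import Data.Fin.Properties as Fin
open import Data.Product using (_×_; _,_)
open import Data.Sum using (inj₁; inj₂)
open import Relation.Binary using (Preorder; tri<; tri≈; tri>)
open import Relation.Binary.PropositionalEquality
  using (_≡_; refl; sym; trans; cong; subst; subst₂)
open import Relation.Nullary using (¬_; yes; no)
open import Data.Empty using (⊥-elim)

module _ {c ℓ₁ ℓ₂} (P : Preorder c ℓ₁ ℓ₂) where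
  open Preorder P using (Carrier; _≲_) renaming (refl to ≲-refl; trans to ≲-trans)

  descending-steps⇒antitone : ∀ {a b} (f : ℕ → Carrier)
    → (∀ i → a ≤ i → i + 1 ≤ b → f (i + 1) ≲ f i)
    → ∀ i j → a ≤ i → i ≤ j → j ≤ b → f j ≲ f i
  descending-steps⇒antitone {a} {b} f step i j a≤i i≤j = go (ℕ.≤⇒≤′ i≤j)
    where
    step′ : ∀ k → a ≤ k → suc k ≤ b → f (suc k) ≲ f k
    step′ k a≤k = subst (λ m → m ≤ b → f m ≲ f k) (ℕ.+-comm k 1) (step k a≤k)

    go : ∀ {k} → i ≤′ k → k ≤ b → f k ≲ f i
    go ≤′-refl _ = ≲-refl
    go (≤′-step {k} i≤′k) k<b =
      ≲-trans (step′ k (ℕ.≤-trans a≤i (ℕ.≤′⇒≤ i≤′k)) k<b) (go i≤′k (ℕ.<⇒≤ k<b))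

suffix : ∀ {A : Set} → ℕ → (ℕ → A) → ℕ → A
suffix m f j = f (m + j)

splice : ∀ {A : Set} → ℕ → (ℕ → A) → (ℕ → A) → ℕ → A
splice zero    f g         = g
splice (suc m) f g zero    = f zero
splice (suc m) f g (suc j) = splice m (λ i → f (suc i)) g j

module _ {A : Set} where

  splice-< : ∀ m (f g : ℕ → A) {j} → j < m → splice m f g j ≡ f j
  splice-< (suc m) f g {zero}  _         = refl
  splice-< (suc m) f g {suc j} (s≤s j<m) = splice-< m (λ i → f (suc i)) g j<m

  splice-+ : ∀ m (f g : ℕ → A) d → splice m f g (m + d) ≡ g d
  splice-+ zero    f g d = refl
  splice-+ (suc m) f g d = splice-+ m (λ i → f (suc i)) g d

  splice-≤ : ∀ m (f g : ℕ → A) {j} → j ≤ m → g 0 ≡ f m → splice m f g j ≡ f j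
  splice-≤ zero    f g {zero}  _         g₀≡fₘ = g₀≡fₘ
  splice-≤ (suc m) f g {zero}  _         _     = refl
  splice-≤ (suc m) f g {suc j} (s≤s j≤m) g₀≡fₘ =
    splice-≤ m (λ i → f (suc i)) g j≤m g₀≡fₘ

data Split (m : ℕ) : ℕ → Set where
  before : ∀ {j} → j < m → Split m j
  after  : ∀ d → Split m (m + d)

split : ∀ m j → Split m j
split zero    j       = after j
split (suc m) zero    = before (s≤s z≤n)
split (suc m) (suc j) with split m j
... | before j<m = before (s≤s j<m)
... | after d    = after d

module _ {σ : ℕ} where

  ≺⇒⋡ : {α β : Str σ} → β ≺ α → ¬ α ⪯ β
  ≺⇒⋡ (k , _ , β<α) (inj₂ α≈β) = Fin.<-irrefl (sym (α≈β k)) β<α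
  ≺⇒⋡ (k , β≡α , β<α) (inj₁ (k′ , α≡β , α<β)) with ℕ.<-cmp k k′
  ... | tri< k<k′ _ _  = Fin.<-irrefl (sym (α≡β k k<k′)) β<α
  ... | tri≈ _ refl _ = Fin.<-asym β<α α<β
  ... | tri> _ _ k′<k  = Fin.<-irrefl (sym (β≡α k′ k′<k)) α<β

  splice-≺ : ∀ m {α β : Str σ} → β ≺ suffix m α → splice m α β ≺ α
  splice-≺ m {α} {β} (d , β≡α , β<α) =
    m + d , agree , subst (Fin._< α (m + d)) (sym (splice-+ m α β d)) β<α
    where
    agree : ∀ j → j < m + d → splice m α β j ≡ α j
    agree j j<m+d with split m j
    ... | before j<m = splice-< m α β j<m
    ... | after e    = trans (splice-+ m α β e) (β≡α e (ℕ.+-cancelˡ-< m e d j<m+d))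

  ascent⇒τ≡3 : ∀ (α : Str σ) {β} k → α k Fin.< α (k + 1) → β ≈ suffix k α → τ≡3 β
  ascent⇒τ≡3 α k ascent β≈ =
    0 , (λ _ ()) , subst₂ Fin._<_ (sym (trans (β≈ 0) (cong α (ℕ.+-identityʳ k)))) (sym (β≈ 1)) ascent

module _ {n σ} (G : Graph n σ) where

  suffix-occurrence : ∀ {u α w} → IsOccurrence G u α w
    → ∀ m → IsOccurrence G (w m) (suffix m α) (suffix m w)
  suffix-occurrence {w = w} (_ , edge , label) m =
    cong w (ℕ.+-identityʳ m)
    , (λ j → subst (λ k → E G (w k) (w (m + j))) (sym (ℕ.+-suc m j)) (edge (m + j)))
    , (λ j → label (m + j))

  splice-occurrence : ∀ {u α w β v} m → IsOccurrence G u α w → IsOccurrence G (w m) β v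
    → IsOccurrence G u (splice m α β) (splice m w v)
  splice-occurrence {α = α} {w} {β} {v} m (w₀≡u , edge , label) (v₀≡wₘ , edge′ , label′) =
    trans (splice-≤ m w v z≤n v₀≡wₘ) w₀≡u , spliced-edge , spliced-label
    where
    spliced-edge : ∀ j → E G (splice m w v (suc j)) (splice m w v j)
    spliced-edge j with split m j
    ... | before j<m = subst₂ (E G)
      (sym (splice-≤ m w v j<m v₀≡wₘ)) (sym (splice-< m w v j<m)) (edge j)
    ... | after d = subst₂ (E G)
      (sym (trans (cong (splice m w v) (sym (ℕ.+-suc m d))) (splice-+ m w v (suc d))))
      (sym (splice-+ m w v d)) (edge′ d)

    spliced-label : ∀ j → lab G (splice m w v j) ≡ splice m α β j
    spliced-label j with split m j
    ... | before j<m = trans (cong (lab G) (splice-< m w v j<m))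
                         (trans (label j) (sym (splice-< m α β j<m)))
    ... | after d    = trans (cong (lab G) (splice-+ m w v d))
                         (trans (label′ d) (sym (splice-+ m α β d)))

  min-suffix : ∀ {u α w β} m → IsMin G u α → IsOccurrence G u α w
    → IsMin G (w m) β → β ≈ suffix m α
  min-suffix m (_ , α-least) occ ((_ , occ′) , β-least)
    with β-least _ (_ , suffix-occurrence occ m)
  ... | inj₂ β≈ = β≈
  ... | inj₁ β≺ = ⊥-elim (≺⇒⋡ (splice-≺ m β≺)
                          (α-least _ (_ , splice-occurrence m occ occ′)))

lemma15 : ∀ {n σ} (G : Graph n σ) → StandingAssumptions G
    → (min : Fin n → Str σ) → (∀ v → IsMin G v (min v))
    → (u : Fin n) → τ≡3 (min u)
    → (w : ℕ → Fin n) → IsOccurrence G u (min u) w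
    → (ℓ : ℕ) → IsEll min w ℓ
    → (∀ i → 2 ≤ i → i + 1 ≤ ℓ → (min u) [ i + 1 ] Fin.≤ (min u) [ i ])
    × (∀ i j → 2 ≤ i → i ≤ j → j ≤ ℓ → (min u) [ j ] Fin.≤ (min u) [ i ])
lemma15 {σ = σ} G _ min isMin u _ w occ ℓ (_ , _ , ℓ-least) =
  no-ascent , descending-steps⇒antitone (Fin.≤-preorder σ) (min u [_]) no-ascent
  where
  no-ascent : ∀ i → 2 ≤ i → i + 1 ≤ ℓ → min u [ i + 1 ] Fin.≤ min u [ i ]
  no-ascent (suc k) (s≤s 1≤k) i+1≤ℓ with min u k Fin.<? min u (k + 1)
  ... | no ¬ascent = ℕ.≮⇒≥ ¬ascent
  ... | yes ascent = ⊥-elim (ℕ.m+1+n≰m (suc k) (ℕ.≤-trans i+1≤ℓ ℓ≤i))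
    where
    ℓ≤i : ℓ ≤ suc k
    ℓ≤i = ℓ-least (suc k) (s≤s 1≤k)
      (inj₂ (ascent⇒τ≡3 (min u) k ascent (min-suffix G k (isMin u) occ (isMin (w k)))))
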